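{- For all nominal sets $X,Y$, the set of equivariant maps $X\to\mathcal{P}_{\mathsf{fs}}Y$ and the set of equivariant maps $X\to\mathcal{P}_{\mathsf{ufs}}Y$ (i.e. the hom-sets $\mathsf{Kl}(\mathcal{P}_{\mathsf{fs}})(X,Y)$ and $\mathsf{Kl}(\mathcal{P}_{\mathsf{ufs}})(X,Y)$), each ordered pointwise by inclusion ($f\le g$ iff $f(x)\subseteq g(x)$ for all $x\in X$), form complete lattices (in particular dcpos with bottom).
   Context: Fix a countably infinite set $\mathbb{A}$ of names and let $\mathrm{Perm}(\mathbb{A})$ be the group of finite permutations of $\mathbb{A}$. A nominal set is a set $X$ with a $\mathrm{Perm}(\mathbb{A})$-action such that every $x\in X$ has a finite support $S\subseteq\mathbb{A}$ (i.e. $\pi\cdot x=x$ whenever $\pi$ fixes $S$ pointwise); $\mathrm{supp}(x)$ denotes the least support. A map is equivariant if it commutes with the actions. For a nominal set $X$, $\mathcal{P}_{\mathsf{fs}}X$ is the nominal set of subsets $S\subseteq X$ that are finitely supported under the action $\pi\cdot S=\{\pi\cdot x: x\in S\}$, and $\mathcal{P}_{\mathsf{ufs}}X$ is the nominal set of uniformly finitely supported subsets, i.e. those $S$ with $\bigcup_{x\in S}\mathrm{supp}(x)$ finite. Both are monads on the category $\mathsf{Nom}$ of nominal sets and equivariant maps, with unit $x\mapsto\{x\}$ and multiplication given by union. -}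

module Defs where

open import Data.Nat using (ℕ)
open import Data.List using (List; _++_)
open import Data.List.Membership.Propositional using (_∈_)
open import Data.List.Membership.Propositional.Properties using (∈-++⁺ˡ; ∈-++⁺ʳ)
open import Data.Product using (Σ; Σ-syntax; _×_; _,_; proj₁; proj₂)
open import Relation.Binary.PropositionalEquality using (_≡_; refl; sym; trans; cong)
open import Relation.Binary.Structures using (IsPartialOrder)
open import Relation.Nullary using (¬_)

Name : Set
Name = ℕ

record Perm : Set where
  field
    to      : Name → Name
    from    : Name → Name
    to∘from : ∀ a → to (from a) ≡ a
    from∘to : ∀ a → from (to a) ≡ a
    finite  : Σ (List Name) λ L → ∀ a → ¬ (a ∈ L) → to a ≡ a

open Perm public

idPerm : Perm
idPerm = record
  { to = λ a → a ; from = λ a → a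
  ; to∘from = λ _ → refl ; from∘to = λ _ → refl
  ; finite = (Data.List.[] , λ _ _ → refl) }

_∘ₚ_ : Perm → Perm → Perm
π ∘ₚ σ = record
  { to = λ a → to π (to σ a)
  ; from = λ a → from σ (from π a)
  ; to∘from = λ a → trans (cong (to π) (to∘from σ (from π a))) (to∘from π a)
  ; from∘to = λ a → trans (cong (from σ) (from∘to π (to σ a))) (from∘to σ a)
  ; finite = (proj₁ (finite σ) ++ proj₁ (finite π)) , λ a a∉ →
      trans (cong (to π) (proj₂ (finite σ) a (λ m → a∉ (∈-++⁺ˡ m))))
            (proj₂ (finite π) a (λ m → a∉ (∈-++⁺ʳ (proj₁ (finite σ)) m)))
  }

Fixes : Perm → List Name → Set
Fixes π A = ∀ a → a ∈ A → to π a ≡ a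

Supports : {C : Set} → (Perm → C → C) → List Name → C → Set
Supports act A x = ∀ π → Fixes π A → act π x ≡ x

record NominalSet : Set₁ where
  field
    Carrier : Set
    act     : Perm → Carrier → Carrier
    act-id  : ∀ x → act idPerm x ≡ x
    act-∘   : ∀ π σ x → act (π ∘ₚ σ) x ≡ act π (act σ x)
    -- permutations are functions: equal permutations act equally
    act-ext : ∀ π σ → (∀ a → to π a ≡ to σ a) → ∀ x → act π x ≡ act σ x
    finSupp : ∀ x → Σ (List Name) λ A → Supports act A x

open NominalSet public

Subset : NominalSet → Set₁
Subset Y = Carrier Y → Set

_⊆_ : {Y : NominalSet} → Subset Y → Subset Y → Set
_⊆_ {Y} S T = ∀ y → S y → T y

_≐_ : {Y : NominalSet} → Subset Y → Subset Y → Set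
_≐_ {Y} S T = _⊆_ {Y} S T × _⊆_ {Y} T S

actSub : (Y : NominalSet) → Perm → Subset Y → Subset Y
actSub Y π S y = Σ[ z ∈ Carrier Y ] (S z × act Y π z ≡ y)

IsFS : (Y : NominalSet) → Subset Y → Set
IsFS Y S = Σ (List Name) λ A → ∀ π → Fixes π A → _≐_ {Y} (actSub Y π S) S

-- S ∈ 𝒫_ufs Y : ⋃_{y∈S} supp(y) is finite, i.e. there is one finite
-- set of names containing (equivalently: supporting) every element's support
IsUFS : (Y : NominalSet) → Subset Y → Set
IsUFS Y S = Σ (List Name) λ A → ∀ y → S y → Supports (act Y) A y

-- Kleisli hom-sets: equivariant maps X → 𝒫 Y, where P selects 𝒫_fs / 𝒫_ufs

record KlHom (X Y : NominalSet) (P : Subset Y → Set) : Set₁ where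
  field
    fun         : Carrier X → Subset Y
    inP         : ∀ x → P (fun x)
    equivariant : ∀ π x → _≐_ {Y} (fun (act X π x)) (actSub Y π (fun x))

open KlHom public

_≤K_ : {X Y : NominalSet} {P : Subset Y → Set} → KlHom X Y P → KlHom X Y P → Set
_≤K_ {X} {Y} f g = ∀ x → _⊆_ {Y} (fun f x) (fun g x)

_≈K_ : {X Y : NominalSet} {P : Subset Y → Set} → KlHom X Y P → KlHom X Y P → Set
_≈K_ {X} {Y} f g = ∀ x → _≐_ {Y} (fun f x) (fun g x)

-- Complete lattices (predicatively: suprema and infima of all families
-- indexed by small types I : Set)

module _ {C : Set₁} (_≤_ : C → C → Set) where

  IsSup : {I : Set} → (I → C) → C → Set₁
  IsSup {I} F s = (∀ i → F i ≤ s) × (∀ u → (∀ i → F i ≤ u) → s ≤ u)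

  IsInf : {I : Set} → (I → C) → C → Set₁
  IsInf {I} F m = (∀ i → m ≤ F i) × (∀ u → (∀ i → u ≤ F i) → u ≤ m)

record IsCompleteLattice {C : Set₁} (_≈_ : C → C → Set) (_≤_ : C → C → Set) : Set₂ where
  field
    isPartialOrder : IsPartialOrder _≈_ _≤_
    sup : ∀ (I : Set) (F : I → C) → Σ C λ s → IsSup _≤_ F s
    inf : ∀ (I : Set) (F : I → C) → Σ C λ m → IsInf _≤_ F m

KlOrderIsCompleteLattice : (X Y : NominalSet) (P : Subset Y → Set) → Set₂
KlOrderIsCompleteLattice X Y P =
  IsCompleteLattice (_≈K_ {X} {Y} {P}) (_≤K_ {X} {Y} {P})

-- Suprema and infima are pointwise unions and intersections.  These are again
-- equivariant, and the value at x of an equivariant map is supported by every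
-- support of x, so it lies in 𝒫_fs Y.  For 𝒫_ufs the key fact is that a
-- uniformly supported set S with support A has all its elements supported by A:
-- given π fixing A, choose σ fixing A such that π fixes the σ-image of the
-- uniform support B of S; then σ⁻¹ π σ fixes B, hence fixes σ⁻¹ y ∈ S, i.e.
-- π fixes y.  Consequently unions of ufs-valued maps are ufs, and
-- x ↦ {y | supp y ⊆ supp x} is the greatest element; intersecting with it keeps
-- meets, including the empty one, uniformly supported.
module Submission where

open import Defs
open import Data.Empty using (⊥-elim)
open import Data.List using (List; []; _∷_; _++_; map)
open import Data.List.Extrema.Nat using (max; xs≤max)
open import Data.List.Membership.Propositional using (_∈_; _∉_)
open import Data.List.Membership.Propositional.Properties using (∈-++⁺ˡ; ∈-++⁺ʳ; ∈-map⁺; ∈-map⁻)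
open import Data.List.Properties using (map-∘; map-cong; map-id)
open import Data.List.Relation.Unary.All using (lookup)
open import Data.List.Relation.Unary.Any using (here; there)
open import Data.Maybe using (Maybe; nothing; just; maybe′)
open import Data.Nat using (suc; _≟_)
open import Data.Nat.Properties using (1+n≰n)
open import Data.Product using (Σ; _×_; _,_; proj₁; proj₂)
open import Data.Unit using (⊤; tt)
open import Function using (_∘_)
open import Relation.Binary.PropositionalEquality
open import Relation.Binary.Structures using (IsPartialOrder)
open import Relation.Nullary using (Dec; yes; no)

fresh : List Name → Name
fresh L = suc (max 0 L)

fresh∉ : ∀ L → fresh L ∉ L
fresh∉ L fresh∈L = 1+n≰n (lookup (xs≤max 0 L) fresh∈L)

transpose : Name → Name → Name → Name
transpose s c n with n ≟ s
... | yes _ = c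
... | no _ with n ≟ c
...   | yes _ = s
...   | no _ = n

transpose-left : ∀ s c → transpose s c s ≡ c
transpose-left s c with s ≟ s
... | yes _ = refl
... | no s≢s = ⊥-elim (s≢s refl)

transpose-right : ∀ s c → transpose s c c ≡ s
transpose-right s c with c ≟ s
... | yes c≡s = c≡s
... | no _ with c ≟ c
...   | yes _ = refl
...   | no c≢c = ⊥-elim (c≢c refl)

transpose-other : ∀ s c n → n ≢ s → n ≢ c → transpose s c n ≡ n
transpose-other s c n n≢s n≢c with n ≟ s
... | yes n≡s = ⊥-elim (n≢s n≡s)
... | no _ with n ≟ c
...   | yes n≡c = ⊥-elim (n≢c n≡c)
...   | no _ = refl

transpose-involutive : ∀ s c n → transpose s c (transpose s c n) ≡ n
transpose-involutive s c n = by-cases (n ≟ s) (n ≟ c)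
  where
    by-cases : Dec (n ≡ s) → Dec (n ≡ c) → transpose s c (transpose s c n) ≡ n
    by-cases (yes refl) _ =
      trans (cong (transpose s c) (transpose-left s c)) (transpose-right s c)
    by-cases (no _) (yes refl) =
      trans (cong (transpose s c) (transpose-right s c)) (transpose-left s c)
    by-cases (no n≢s) (no n≢c) = trans (cong (transpose s c) τn≡n) τn≡n
      where τn≡n = transpose-other s c n n≢s n≢c

transposition : Name → Name → Perm
transposition s c = record
  { to = transpose s c ; from = transpose s c
  ; to∘from = transpose-involutive s c ; from∘to = transpose-involutive s c
  ; finite = (s ∷ c ∷ []) , λ a a∉ →
      transpose-other s c a (λ a≡s → a∉ (here a≡s)) (λ a≡c → a∉ (there (here a≡c)))
  }

_⁻¹ : Perm → Perm
π ⁻¹ = record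
  { to = from π ; from = to π ; to∘from = from∘to π ; from∘to = to∘from π
  ; finite = proj₁ (finite π) , λ a a∉ →
      trans (cong (from π) (sym (proj₂ (finite π) a a∉))) (from∘to π a)
  }

⁻¹-fixes : ∀ {π A} → Fixes π A → Fixes (π ⁻¹) A
⁻¹-fixes {π} π-fixes a a∈A = trans (cong (from π) (sym (π-fixes a a∈A))) (from∘to π a)

map-from∘to : ∀ σ A → map (from σ) (map (to σ) A) ≡ A
map-from∘to σ A = trans (sym (map-∘ A)) (trans (map-cong (from∘to σ) A) (map-id A))

map-to∘from : ∀ σ A → map (to σ) (map (from σ) A) ≡ A
map-to∘from σ = map-from∘to (σ ⁻¹)

module _ (Z : NominalSet) where

  act-inverseˡ : ∀ σ z → act Z (σ ⁻¹) (act Z σ z) ≡ z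
  act-inverseˡ σ z = trans (sym (act-∘ Z (σ ⁻¹) σ z))
    (trans (act-ext Z ((σ ⁻¹) ∘ₚ σ) idPerm (from∘to σ) z) (act-id Z z))

  act-inverseʳ : ∀ σ z → act Z σ (act Z (σ ⁻¹) z) ≡ z
  act-inverseʳ σ z = trans (sym (act-∘ Z σ (σ ⁻¹) z))
    (trans (act-ext Z (σ ∘ₚ (σ ⁻¹)) idPerm (to∘from σ) z) (act-id Z z))

  supports-act : ∀ σ B z → Supports (act Z) (map (from σ) B) z →
                 Supports (act Z) B (act Z σ z)
  supports-act σ B z σ⁻¹B-supports π π-fixes-B = begin
    act Z π (act Z σ z)       ≡⟨ sym (act-∘ Z π σ z) ⟩
    act Z (π ∘ₚ σ) z          ≡⟨ act-ext Z (π ∘ₚ σ) (σ ∘ₚ ρ) (λ a → sym (to∘from σ _)) z ⟩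
    act Z (σ ∘ₚ ρ) z          ≡⟨ act-∘ Z σ ρ z ⟩
    act Z σ (act Z ρ z)       ≡⟨ cong (act Z σ) (σ⁻¹B-supports ρ ρ-fixes) ⟩
    act Z σ z                 ∎
    where
      open ≡-Reasoning
      ρ = (σ ⁻¹) ∘ₚ (π ∘ₚ σ)
      ρ-fixes : Fixes ρ (map (from σ) B)
      ρ-fixes a a∈σ⁻¹B with ∈-map⁻ (from σ) a∈σ⁻¹B
      ... | b , b∈B , refl =
        cong (from σ) (trans (cong (to π) (to∘from σ b)) (π-fixes-B b b∈B))

Fixed : Perm → Name → Set
Fixed π n = to π n ≡ n

module _ (π : Perm) (A : List Name) (π-fixes-A : Fixes π A) where

  relocate : (B : List Name) →
             Σ Perm λ σ → Fixes σ A × (∀ b → b ∈ B → Fixed π (to σ b))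
  relocate [] = idPerm , (λ _ _ → refl) , λ _ ()
  relocate (b ∷ B) with relocate B
  ... | σ , σ-fixes-A , σB-fixed with to π (to σ b) ≟ to σ b
  ...   | yes σb-fixed =
          σ , σ-fixes-A , λ { _ (here refl) → σb-fixed ; b' (there b'∈B) → σB-fixed b' b'∈B }
  ...   | no σb-moved = transposition s c ∘ₚ σ , τσ-fixes-A , τσ-relocates
    where
      -- π moves s = σ b, so s ∉ A; swap it with a name c fresh for A, π and σ B
      s = to σ b
      L = proj₁ (finite π)
      c = fresh (A ++ L ++ map (to σ) B)
      c∉ : c ∉ A ++ L ++ map (to σ) B
      c∉ = fresh∉ (A ++ L ++ map (to σ) B)
      c-fixed : Fixed π c
      c-fixed = proj₂ (finite π) c (λ c∈L → c∉ (∈-++⁺ʳ A (∈-++⁺ˡ c∈L)))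
      τσ-fixes-A : Fixes (transposition s c ∘ₚ σ) A
      τσ-fixes-A a a∈A = trans (cong (transpose s c) (σ-fixes-A a a∈A))
        (transpose-other s c a
          (λ { refl → σb-moved (π-fixes-A a a∈A) })
          (λ { refl → c∉ (∈-++⁺ˡ a∈A) }))
      τσ-relocates : ∀ b' → b' ∈ b ∷ B → Fixed π (transpose s c (to σ b'))
      τσ-relocates _ (here refl) = subst (Fixed π) (sym (transpose-left s c)) c-fixed
      τσ-relocates b' (there b'∈B) =
        subst (Fixed π) (sym (transpose-other s c (to σ b') σb'≢s σb'≢c)) (σB-fixed b' b'∈B)
        where
          σb'≢s : to σ b' ≢ s
          σb'≢s σb'≡s = σb-moved (subst (Fixed π) σb'≡s (σB-fixed b' b'∈B))
          σb'≢c : to σ b' ≢ c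
          σb'≢c σb'≡c = c∉ (∈-++⁺ʳ A (∈-++⁺ʳ L
            (subst (_∈ map (to σ) B) σb'≡c (∈-map⁺ (to σ) b'∈B))))

module _ (Y : NominalSet) where

  ufs-supported⇒elements-supported : (A : List Name) (S : Subset Y) →
    (∀ π → Fixes π A → _⊆_ {Y} (actSub Y π S) S) → IsUFS Y S →
    ∀ y → S y → Supports (act Y) A y
  ufs-supported⇒elements-supported A S A-supports-S (B , B-supports-all) y y∈S π π-fixes-A
      with relocate π A π-fixes-A B
  ... | σ , σ-fixes-A , σB-fixed = begin
    act Y π y                            ≡⟨ act-inverseʳ Y σ (act Y π y) ⟨
    act Y σ (act Y (σ ⁻¹) (act Y π y))   ≡⟨ cong (act Y σ) ρy'≡σ⁻¹πy ⟨
    act Y σ (act Y ρ y')                 ≡⟨ cong (act Y σ) (B-supports-all y' y'∈S ρ ρ-fixes-B) ⟩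
    act Y σ y'                           ≡⟨ act-inverseʳ Y σ y ⟩
    y                                    ∎
    where
      open ≡-Reasoning
      ρ = (σ ⁻¹) ∘ₚ (π ∘ₚ σ)
      ρ-fixes-B : Fixes ρ B
      ρ-fixes-B b b∈B = trans (cong (from σ) (σB-fixed b b∈B)) (from∘to σ b)
      y' = act Y (σ ⁻¹) y
      y'∈S : S y'
      y'∈S = A-supports-S (σ ⁻¹) (⁻¹-fixes {σ} σ-fixes-A) y' (y , y∈S , refl)
      ρy'≡σ⁻¹πy : act Y ρ y' ≡ act Y (σ ⁻¹) (act Y π y)
      ρy'≡σ⁻¹πy = trans (act-∘ Y (σ ⁻¹) (π ∘ₚ σ) y') (cong (act Y (σ ⁻¹))
        (trans (act-∘ Y π σ y') (cong (act Y π) (act-inverseʳ Y σ y))))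

module _ (X Y : NominalSet) where

  Equivariant : (Carrier X → Subset Y) → Set
  Equivariant g = ∀ π x → _≐_ {Y} (g (act X π x)) (actSub Y π (g x))

  equivariant-supported : ∀ {g} → Equivariant g → ∀ {A x} → Supports (act X) A x →
    ∀ π → Fixes π A → _≐_ {Y} (actSub Y π (g x)) (g x)
  equivariant-supported {g} g-equivariant {x = x} A-supports-x π π-fixes-A =
    (λ y πy∈ → subst (λ w → g w y) πx≡x (proj₂ (g-equivariant π x) y πy∈)) ,
    (λ y y∈ → proj₁ (g-equivariant π x) y (subst (λ w → g w y) (sym πx≡x) y∈))
    where
      πx≡x : act X π x ≡ x
      πx≡x = A-supports-x π π-fixes-A

  equivariant⇒fs : ∀ {g} → Equivariant g → ∀ x → IsFS Y (g x)
  equivariant⇒fs g-equivariant x =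
    proj₁ (finSupp X x) , equivariant-supported g-equivariant (proj₂ (finSupp X x))

  equivariant-ufs⇒elements-supported : ∀ {g} → Equivariant g → (∀ x → IsUFS Y (g x)) →
    ∀ x A → Supports (act X) A x → ∀ y → g x y → Supports (act Y) A y
  equivariant-ufs⇒elements-supported g-equivariant g-ufs x A A-supports-x =
    ufs-supported⇒elements-supported Y A _
      (λ π π-fixes-A → proj₁ (equivariant-supported g-equivariant A-supports-x π π-fixes-A))
      (g-ufs x)

  ⋃ ⋂ : {I : Set} → (I → Carrier X → Subset Y) → Carrier X → Subset Y
  ⋃ {I} G x y = Σ I λ i → G i x y
  ⋂ {I} G x y = ∀ i → G i x y

  ⋃-equivariant : ∀ {I} (G : I → Carrier X → Subset Y) →
                  (∀ i → Equivariant (G i)) → Equivariant (⋃ G)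
  ⋃-equivariant G G-equivariant π x =
    (λ { y (i , y∈) → let (z , z∈ , πz≡y) = proj₁ (G-equivariant i π x) y y∈
                      in z , (i , z∈) , πz≡y }) ,
    (λ { y (z , (i , z∈) , πz≡y) → i , proj₂ (G-equivariant i π x) y (z , z∈ , πz≡y) })

  ⋂-equivariant : ∀ {I} (G : I → Carrier X → Subset Y) →
                  (∀ i → Equivariant (G i)) → Equivariant (⋂ G)
  ⋂-equivariant G G-equivariant π x =
    (λ y y∈ → act Y (π ⁻¹) y , (λ i → π⁻¹y∈ y i (y∈ i)) , act-inverseʳ Y π y) ,
    (λ { y (z , z∈ , πz≡y) i → proj₂ (G-equivariant i π x) y (z , z∈ i , πz≡y) })
    where
      π⁻¹y∈ : ∀ y i → G i (act X π x) y → G i x (act Y (π ⁻¹) y)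
      π⁻¹y∈ y i y∈ with proj₁ (G-equivariant i π x) y y∈
      ... | z , z∈ , refl = subst (G i x) (sym (act-inverseˡ Y π z)) z∈

  -- y ∈ SuppBelow x iff supp y ⊆ supp x
  SuppBelow : Carrier X → Subset Y
  SuppBelow x y = ∀ A → Supports (act X) A x → Supports (act Y) A y

  SuppBelow-equivariant : Equivariant SuppBelow
  SuppBelow-equivariant σ x =
    (λ y y∈ → act Y (σ ⁻¹) y , (λ A A-supports-x → supports-act Y (σ ⁻¹) A y
                                   (y∈ (map (to σ) A) (σA-supports-σx A A-supports-x))) ,
              act-inverseʳ Y σ y) ,
    (λ { _ (z , z∈ , refl) A A-supports-σx → supports-act Y σ A z
           (z∈ (map (from σ) A) (σ⁻¹A-supports-x A A-supports-σx)) })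
    where
      σA-supports-σx : ∀ A → Supports (act X) A x →
                       Supports (act X) (map (to σ) A) (act X σ x)
      σA-supports-σx A A-supports-x = supports-act X σ (map (to σ) A) x
        (subst (λ L → Supports (act X) L x) (sym (map-from∘to σ A)) A-supports-x)
      σ⁻¹A-supports-x : ∀ A → Supports (act X) A (act X σ x) →
                        Supports (act X) (map (from σ) A) x
      σ⁻¹A-supports-x A A-supports-σx =
        subst (Supports (act X) (map (from σ) A)) (act-inverseˡ X σ x)
          (supports-act X (σ ⁻¹) (map (from σ) A) (act X σ x)
            (subst (λ L → Supports (act X) L (act X σ x)) (sym (map-to∘from σ A)) A-supports-σx))

module _ {X Y : NominalSet} {P : Subset Y → Set} where

  ≤K-isPartialOrder : IsPartialOrder (_≈K_ {X} {Y} {P}) (_≤K_ {X} {Y} {P})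
  ≤K-isPartialOrder = record
    { isPreorder = record
      { isEquivalence = record
        { refl = λ _ → (λ _ y∈ → y∈) , (λ _ y∈ → y∈)
        ; sym = λ f≈g x → proj₂ (f≈g x) , proj₁ (f≈g x)
        ; trans = λ f≈g g≈h x → (λ y y∈ → proj₁ (g≈h x) y (proj₁ (f≈g x) y y∈))
                              , (λ y y∈ → proj₂ (f≈g x) y (proj₂ (g≈h x) y y∈))
        }
      ; reflexive = λ f≈g x → proj₁ (f≈g x)
      ; trans = λ f≤g g≤h x y y∈ → g≤h x y (f≤g x y y∈)
      }
    ; antisym = λ f≤g g≤f x → f≤g x , g≤f x
    }

  module _ {I : Set} (F : I → KlHom X Y P) where

    ⋃K : (∀ x → P (⋃ X Y (fun ∘ F) x)) → KlHom X Y P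
    ⋃K ⋃-in-P = record
      { fun = ⋃ X Y (fun ∘ F)
      ; inP = ⋃-in-P
      ; equivariant = ⋃-equivariant X Y (fun ∘ F) (equivariant ∘ F)
      }

    ⋃K-isSup : (⋃-in-P : ∀ x → P (⋃ X Y (fun ∘ F) x)) →
               IsSup (_≤K_ {X} {Y} {P}) F (⋃K ⋃-in-P)
    ⋃K-isSup _ = (λ i x y y∈ → i , y∈) , (λ u F≤u x y (i , y∈) → F≤u i x y y∈)

    -- meets also include a greatest element ⊤K, so that they stay in P when I is empty
    module _ (⊤K : KlHom X Y P) where

      F⊤ : Maybe I → KlHom X Y P
      F⊤ = maybe′ F ⊤K

      ⋂K : (∀ x → P (⋂ X Y (fun ∘ F⊤) x)) → KlHom X Y P
      ⋂K ⋂-in-P = record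
        { fun = ⋂ X Y (fun ∘ F⊤)
        ; inP = ⋂-in-P
        ; equivariant = ⋂-equivariant X Y (fun ∘ F⊤) (equivariant ∘ F⊤)
        }

      ⋂K-isInf : (∀ f → _≤K_ {X} {Y} {P} f ⊤K) →
                 (⋂-in-P : ∀ x → P (⋂ X Y (fun ∘ F⊤) x)) →
                 IsInf (_≤K_ {X} {Y} {P}) F (⋂K ⋂-in-P)
      ⋂K-isInf ⊤K-greatest _ =
        (λ i x y y∈ → y∈ (just i)) ,
        (λ { u _ x y y∈ nothing → ⊤K-greatest u x y y∈
           ; u u≤F x y y∈ (just i) → u≤F i x y y∈ })

module _ (X Y : NominalSet) where

  fullK : KlHom X Y (IsFS Y)
  fullK = record
    { fun = λ _ _ → ⊤
    ; inP = equivariant⇒fs X Y full-equivariant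
    ; equivariant = full-equivariant
    }
    where
      full-equivariant : Equivariant X Y (λ _ _ → ⊤)
      full-equivariant π x = (λ y _ → act Y (π ⁻¹) y , tt , act-inverseʳ Y π y) , (λ _ _ → tt)

  fs-isCompleteLattice : KlOrderIsCompleteLattice X Y (IsFS Y)
  fs-isCompleteLattice = record
    { isPartialOrder = ≤K-isPartialOrder
    ; sup = λ I F →
        let ⋃-fs = equivariant⇒fs X Y (⋃-equivariant X Y (fun ∘ F) (equivariant ∘ F))
        in ⋃K F ⋃-fs , ⋃K-isSup F ⋃-fs
    ; inf = λ I F →
        let ⋂-fs = equivariant⇒fs X Y
                     (⋂-equivariant X Y (fun ∘ F⊤ F fullK) (equivariant ∘ F⊤ F fullK))
        in ⋂K F fullK ⋂-fs , ⋂K-isInf F fullK (λ _ _ _ _ → tt) ⋂-fs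
    }

  SuppBelowK : KlHom X Y (IsUFS Y)
  SuppBelowK = record
    { fun = SuppBelow X Y
    ; inP = λ x → proj₁ (finSupp X x) , λ y y∈ → y∈ _ (proj₂ (finSupp X x))
    ; equivariant = SuppBelow-equivariant X Y
    }

  SuppBelowK-greatest : ∀ f → _≤K_ {X} {Y} {IsUFS Y} f SuppBelowK
  SuppBelowK-greatest f x y y∈ A A-supports-x =
    equivariant-ufs⇒elements-supported X Y (equivariant f) (inP f) x A A-supports-x y y∈

  ufs-isCompleteLattice : KlOrderIsCompleteLattice X Y (IsUFS Y)
  ufs-isCompleteLattice = record
    { isPartialOrder = ≤K-isPartialOrder
    ; sup = λ I F →
        let ⋃-ufs = λ x → proj₁ (finSupp X x) , λ { y (i , y∈) →
                      SuppBelowK-greatest (F i) x y y∈ _ (proj₂ (finSupp X x)) }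
        in ⋃K F ⋃-ufs , ⋃K-isSup F ⋃-ufs
    ; inf = λ I F →
        let ⋂-ufs = λ x → proj₁ (inP SuppBelowK x) , λ y y∈ →
                      proj₂ (inP SuppBelowK x) y (y∈ nothing)
        in ⋂K F SuppBelowK ⋂-ufs , ⋂K-isInf F SuppBelowK SuppBelowK-greatest ⋂-ufs
    }

mainTheorem3 : (X Y : NominalSet) →
    KlOrderIsCompleteLattice X Y (IsFS Y) × KlOrderIsCompleteLattice X Y (IsUFS Y)
mainTheorem3 X Y = fs-isCompleteLattice X Y , ufs-isCompleteLattice X Y
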